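{- Let $M=(E,\mathcal{I})$ be a matroid on a finite set $E$ with $r(M)>0$. For every $B\in\mathcal{B}(M)$, $\bigcup F_M(B)=\bigcup\mathcal{B}(M)$.
   Context: $\mathcal{B}(M)$ is the family of bases, $r(M)$ the common cardinality of bases, $r(X)$ the rank of $X\subseteq E$. $s(M)=\{A\in\mathcal{I}: |A|=r(M)-1\}$. For $X\subseteq E$, $K_M(X)=\{a\in E: r(X\cup\{a\})=r(X)+1\}$. $F_M(B)=\{K_M(X): X\in s(M),\ X\subseteq B\}$. -}

module Defs where

open import Level using (Level; suc; _⊔_)
open import Data.Nat using (ℕ; _<_; _≤_; _+_)
open import Data.Fin using (Fin)
open import Data.Fin.Subset using (Subset; ⊥; _∈_; _∉_; _⊆_; _∪_; ⁅_⁆; ∣_∣)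
open import Data.Product using (Σ; ∃; _×_)
open import Relation.Binary.PropositionalEquality using (_≡_)

record Matroid (n : ℕ) : Set₁ where
  field
    Independent  : Subset n → Set
    indep-empty  : Independent ⊥
    indep-subset : ∀ {X Y} → Y ⊆ X → Independent X → Independent Y
    indep-augment : ∀ {X Y} → Independent X → Independent Y → ∣ X ∣ < ∣ Y ∣ →
                    ∃ λ y → y ∈ Y × y ∉ X × Independent (X ∪ ⁅ y ⁆)

module _ {n : ℕ} (M : Matroid n) where
  open Matroid M

  IsBasis : Subset n → Set
  IsBasis B = Independent B × (∀ Y → Independent Y → B ⊆ Y → Y ⊆ B)

  HasRank : Subset n → ℕ → Set
  HasRank X k = (Σ (Subset n) λ Y → Y ⊆ X × Independent Y × ∣ Y ∣ ≡ k)
              × (∀ Y → Y ⊆ X → Independent Y → ∣ Y ∣ ≤ k)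

  MatroidRank : ℕ → Set
  MatroidRank k = ∀ B → IsBasis B → ∣ B ∣ ≡ k

  InK : Subset n → Fin n → Set
  InK X a = Σ ℕ λ k → HasRank X k × HasRank (X ∪ ⁅ a ⁆) (k + 1)

  -- X ∈ s(M), given r(M) = k : X independent with |X| = k - 1 (stated as |X| + 1 = k, k > 0)
  InS : ℕ → Subset n → Set
  InS k X = Independent X × ∣ X ∣ + 1 ≡ k

  -- a ∈ ⋃ F_M(B)  :⇔  a ∈ K_M(X) for some X ∈ s(M) with X ⊆ B
  InUnionF : ℕ → Subset n → Fin n → Set
  InUnionF k B a = Σ (Subset n) λ X → InS k X × X ⊆ B × InK X a

  InUnionBases : Fin n → Set
  InUnionBases a = Σ (Subset n) λ B' → IsBasis B' × a ∈ B'

-- An element lies in some basis exactly when it is not a loop, i.e. ⁅ a ⁆ is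
-- independent.  If a ∈ K(X) then an independent set of size r(X) + 1 inside
-- X ∪ ⁅ a ⁆ must contain a, so a is not a loop.  Conversely, augmenting ⁅ a ⁆
-- from B yields a basis I ⊆ ⁅ a ⁆ ∪ B containing a, and X = I - a is an
-- independent subset of B of size r(M) - 1 with a ∈ K(X), since
-- r(X) = |X| and r(X ∪ ⁅ a ⁆) = |I| = |X| + 1.
module Submission where

open import Defs
open import Data.Nat using (ℕ; zero; suc; _+_; _<_; _≤_; z≤n; s≤s)
open import Data.Nat.Properties
  using (≤-antisym; <⇒≱; +-comm; +-suc; +-identityʳ; m<m+n; _<?_; ≮⇒≥; m≤n⇒∃[o]m+o≡n)
open import Data.Fin using (Fin; zero; suc)
open import Data.Fin.Properties using (_≟_)
open import Data.Fin.Subset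
  using (Subset; _∈_; _∉_; _⊆_; _∪_; ⁅_⁆; ∣_∣; _-_; inside; outside)
open import Data.Fin.Subset.Properties
  using ( _∈?_; ⊆-trans; x∈⁅x⁆; x∈⁅y⁆⇒x≡y; p⊆q⇒∣p∣≤∣q∣; p⊆p∪q; q⊆p∪q; x∈p∪q⁻
        ; ∪-identityʳ; p─q⊆p; x∈p∧x≢y⇒x∈p-y; x∈p⇒∣p-x∣<∣p∣)
open import Data.Vec.Base using (_∷_; here; there)
open import Data.Product using (Σ; _×_; _,_; proj₁; proj₂)
open import Data.Sum using (inj₁; inj₂)
open import Relation.Nullary using (yes; no; contradiction)
open import Relation.Binary.PropositionalEquality
  using (_≡_; refl; sym; trans; cong; subst)
open import Function.Base using (_∘_)
open import Function.Bundles using (_⇔_; mk⇔)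

∪-least : ∀ {n} {p q r : Subset n} → p ⊆ r → q ⊆ r → p ∪ q ⊆ r
∪-least {p = p} {q} p⊆r q⊆r x∈p∪q with x∈p∪q⁻ p q x∈p∪q
... | inj₁ x∈p = p⊆r x∈p
... | inj₂ x∈q = q⊆r x∈q

x∈p⇒⁅x⁆⊆p : ∀ {n} {x : Fin n} {p : Subset n} → x ∈ p → ⁅ x ⁆ ⊆ p
x∈p⇒⁅x⁆⊆p {x = x} {p} x∈p y∈⁅x⁆ = subst (_∈ p) (sym (x∈⁅y⁆⇒x≡y x y∈⁅x⁆)) x∈p

x∉p-x : ∀ {n} (p : Subset n) (x : Fin n) → x ∉ p - x
x∉p-x (inside ∷ p)  zero    ()
x∉p-x (outside ∷ p) zero    ()
x∉p-x (_ ∷ p)       (suc x) (there x∈p-x) = x∉p-x p x x∈p-x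

p⊆p-x∪⁅x⁆ : ∀ {n} (p : Subset n) (x : Fin n) → p ⊆ (p - x) ∪ ⁅ x ⁆
p⊆p-x∪⁅x⁆ p x {y} y∈p with y ≟ x
... | yes refl = q⊆p∪q (p - x) ⁅ x ⁆ (x∈⁅x⁆ x)
... | no y≢x   = p⊆p∪q ⁅ x ⁆ (x∈p∧x≢y⇒x∈p-y y∈p y≢x)

p⊆q∪⁅x⁆∧x∉p⇒p⊆q : ∀ {n} {p q : Subset n} {x : Fin n} →
                    p ⊆ q ∪ ⁅ x ⁆ → x ∉ p → p ⊆ q
p⊆q∪⁅x⁆∧x∉p⇒p⊆q {q = q} {x} p⊆q∪⁅x⁆ x∉p y∈p with x∈p∪q⁻ q ⁅ x ⁆ (p⊆q∪⁅x⁆ y∈p)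
... | inj₁ y∈q   = y∈q
... | inj₂ y∈⁅x⁆ = contradiction (subst (_∈ _) (x∈⁅y⁆⇒x≡y x y∈⁅x⁆) y∈p) x∉p

p⊆⁅x⁆∪q⇒p-x⊆q : ∀ {n} {p q : Subset n} {x : Fin n} → p ⊆ ⁅ x ⁆ ∪ q → p - x ⊆ q
p⊆⁅x⁆∪q⇒p-x⊆q {p = p} {q} {x} p⊆⁅x⁆∪q y∈p-x
  with x∈p∪q⁻ ⁅ x ⁆ q (p⊆⁅x⁆∪q (p─q⊆p p ⁅ x ⁆ y∈p-x))
... | inj₂ y∈q   = y∈q
... | inj₁ y∈⁅x⁆ = contradiction (subst (_∈ p - x) (x∈⁅y⁆⇒x≡y x y∈⁅x⁆) y∈p-x) (x∉p-x p x)

∣p∪⁅x⁆∣≡1+∣p∣ : ∀ {n} (p : Subset n) (x : Fin n) → x ∉ p → ∣ p ∪ ⁅ x ⁆ ∣ ≡ suc ∣ p ∣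
∣p∪⁅x⁆∣≡1+∣p∣ (inside ∷ p)  zero    x∉p = contradiction here x∉p
∣p∪⁅x⁆∣≡1+∣p∣ (outside ∷ p) zero    _   = cong (suc ∘ ∣_∣) (∪-identityʳ p)
∣p∪⁅x⁆∣≡1+∣p∣ (inside ∷ p)  (suc x) x∉p = cong suc (∣p∪⁅x⁆∣≡1+∣p∣ p x (x∉p ∘ there))
∣p∪⁅x⁆∣≡1+∣p∣ (outside ∷ p) (suc x) x∉p = ∣p∪⁅x⁆∣≡1+∣p∣ p x (x∉p ∘ there)

∣p-x∣+1≡∣p∣ : ∀ {n} {p : Subset n} {x : Fin n} → x ∈ p → ∣ p - x ∣ + 1 ≡ ∣ p ∣
∣p-x∣+1≡∣p∣ {p = p} {x} x∈p = ≤-antisym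
  (subst (_≤ ∣ p ∣) (+-comm 1 ∣ p - x ∣) (x∈p⇒∣p-x∣<∣p∣ x∈p))
  (subst (∣ p ∣ ≤_) (trans (∣p∪⁅x⁆∣≡1+∣p∣ (p - x) x (x∉p-x p x)) (+-comm 1 ∣ p - x ∣))
         (p⊆q⇒∣p∣≤∣q∣ (p⊆p-x∪⁅x⁆ p x)))

module _ {n : ℕ} (M : Matroid n) where
  open Matroid M

  independent⇒hasRank : ∀ {X} → Independent X → HasRank M X ∣ X ∣
  independent⇒hasRank {X} indX =
    (X , (λ x∈X → x∈X) , indX , refl) , λ _ Y⊆X _ → p⊆q⇒∣p∣≤∣q∣ Y⊆X

  ∣independent∣≤∣basis∣ : ∀ {B Y} → IsBasis M B → Independent Y → ∣ Y ∣ ≤ ∣ B ∣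
  ∣independent∣≤∣basis∣ {B} {Y} (indB , maxB) indY with ∣ B ∣ <? ∣ Y ∣
  ... | no ∣B∣≮∣Y∣ = ≮⇒≥ ∣B∣≮∣Y∣
  ... | yes ∣B∣<∣Y∣ with indep-augment indB indY ∣B∣<∣Y∣
  ... | y , _ , y∉B , indB∪⁅y⁆ =
    contradiction (maxB (B ∪ ⁅ y ⁆) indB∪⁅y⁆ (p⊆p∪q ⁅ y ⁆) (q⊆p∪q B ⁅ y ⁆ (x∈⁅x⁆ y))) y∉B

  maximum-size⇒isBasis : ∀ {I} → Independent I → (∀ Y → Independent Y → ∣ Y ∣ ≤ ∣ I ∣) →
                         IsBasis M I
  maximum-size⇒isBasis {I} indI maximum = indI , I-maximal
    where
    I-maximal : ∀ Y → Independent Y → I ⊆ Y → Y ⊆ I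
    I-maximal Y indY I⊆Y {x} x∈Y with x ∈? I
    ... | yes x∈I = x∈I
    ... | no x∉I  = contradiction (maximum Y indY) (<⇒≱ ∣I∣<∣Y∣)
      where
      ∣I∣<∣Y∣ : ∣ I ∣ < ∣ Y ∣
      ∣I∣<∣Y∣ = subst (_≤ ∣ Y ∣) (∣p∪⁅x⁆∣≡1+∣p∣ I x x∉I)
                      (p⊆q⇒∣p∣≤∣q∣ (∪-least I⊆Y (x∈p⇒⁅x⁆⊆p x∈Y)))

  augment-from : ∀ {B J} → Independent B → Independent J → ∣ J ∣ ≤ ∣ B ∣ →
                 Σ (Subset n) λ I → J ⊆ I × I ⊆ J ∪ B × Independent I × ∣ I ∣ ≡ ∣ B ∣
  augment-from {B} {J} indB indJ ∣J∣≤∣B∣ = go J indJ (proj₂ (m≤n⇒∃[o]m+o≡n ∣J∣≤∣B∣))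
    where
    go : ∀ {m} J → Independent J → ∣ J ∣ + m ≡ ∣ B ∣ →
         Σ (Subset n) λ I → J ⊆ I × I ⊆ J ∪ B × Independent I × ∣ I ∣ ≡ ∣ B ∣
    go {zero} J indJ ∣J∣+0≡∣B∣ =
      J , (λ x∈J → x∈J) , p⊆p∪q B , indJ , trans (sym (+-identityʳ ∣ J ∣)) ∣J∣+0≡∣B∣
    go {suc m} J indJ ∣J∣+1+m≡∣B∣ with indep-augment indJ indB
                                        (subst (∣ J ∣ <_) ∣J∣+1+m≡∣B∣ (m<m+n ∣ J ∣ (s≤s z≤n)))
    ... | y , y∈B , y∉J , indJ∪⁅y⁆ with go (J ∪ ⁅ y ⁆) indJ∪⁅y⁆
          (trans (cong (_+ m) (∣p∪⁅x⁆∣≡1+∣p∣ J y y∉J)) (trans (sym (+-suc ∣ J ∣ m)) ∣J∣+1+m≡∣B∣))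
    ... | I , J∪⁅y⁆⊆I , I⊆J∪⁅y⁆∪B , indI , ∣I∣≡∣B∣ =
      I , ⊆-trans (p⊆p∪q ⁅ y ⁆) J∪⁅y⁆⊆I ,
      ⊆-trans I⊆J∪⁅y⁆∪B (∪-least (∪-least (p⊆p∪q B) (⊆-trans (x∈p⇒⁅x⁆⊆p y∈B) (q⊆p∪q J B)))
                                 (q⊆p∪q J B)) ,
      indI , ∣I∣≡∣B∣

  augment-to-basis : ∀ {B J} → IsBasis M B → Independent J →
                     Σ (Subset n) λ I → J ⊆ I × I ⊆ J ∪ B × IsBasis M I
  augment-to-basis bB indJ with augment-from (proj₁ bB) indJ (∣independent∣≤∣basis∣ bB indJ)
  ... | I , J⊆I , I⊆J∪B , indI , ∣I∣≡∣B∣ = I , J⊆I , I⊆J∪B , maximum-size⇒isBasis indI ∣Y∣≤∣I∣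
    where
    ∣Y∣≤∣I∣ : ∀ Y → Independent Y → ∣ Y ∣ ≤ ∣ I ∣
    ∣Y∣≤∣I∣ Y indY = subst (∣ Y ∣ ≤_) (sym ∣I∣≡∣B∣) (∣independent∣≤∣basis∣ bB indY)

  basis⇒hasRank : ∀ {I X} → IsBasis M I → I ⊆ X → HasRank M X ∣ I ∣
  basis⇒hasRank {I} bI I⊆X =
    (I , I⊆X , proj₁ bI , refl) , λ _ _ indY → ∣independent∣≤∣basis∣ bI indY

  basis-element∈K : ∀ {I a} → IsBasis M I → a ∈ I → InK M (I - a) a
  basis-element∈K {I} {a} bI a∈I =
    ∣ I - a ∣ ,
    independent⇒hasRank (indep-subset (p─q⊆p I ⁅ a ⁆) (proj₁ bI)) ,
    subst (HasRank M ((I - a) ∪ ⁅ a ⁆)) (sym (∣p-x∣+1≡∣p∣ a∈I))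
          (basis⇒hasRank bI (p⊆p-x∪⁅x⁆ I a))

  K⇒nonloop : ∀ {X a} → InK M X a → Independent ⁅ a ⁆
  K⇒nonloop {a = a} (j , (_ , rX≤j) , (Z , Z⊆X∪⁅a⁆ , indZ , ∣Z∣≡j+1) , _) with a ∈? Z
  ... | yes a∈Z = indep-subset (x∈p⇒⁅x⁆⊆p a∈Z) indZ
  ... | no a∉Z  = contradiction (rX≤j Z (p⊆q∪⁅x⁆∧x∉p⇒p⊆q Z⊆X∪⁅a⁆ a∉Z) indZ)
                                (<⇒≱ (subst (j <_) (sym ∣Z∣≡j+1) (m<m+n j (s≤s z≤n))))

  inBasis⇒nonloop : ∀ {a} → InUnionBases M a → Independent ⁅ a ⁆
  inBasis⇒nonloop (_ , (indB′ , _) , a∈B′) = indep-subset (x∈p⇒⁅x⁆⊆p a∈B′) indB′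

  nonloop⇒inBasis : ∀ {B a} → IsBasis M B → Independent ⁅ a ⁆ → InUnionBases M a
  nonloop⇒inBasis bB ind⁅a⁆ with augment-to-basis bB ind⁅a⁆
  ... | I , ⁅a⁆⊆I , _ , bI = I , bI , ⁅a⁆⊆I (x∈⁅x⁆ _)

  nonloop⇒inUnionF : ∀ {k B a} → MatroidRank M k → IsBasis M B → Independent ⁅ a ⁆ →
                     InUnionF M k B a
  nonloop⇒inUnionF {a = a} rk bB ind⁅a⁆ with augment-to-basis bB ind⁅a⁆
  ... | I , ⁅a⁆⊆I , I⊆⁅a⁆∪B , bI =
    I - a ,
    (indep-subset (p─q⊆p I ⁅ a ⁆) (proj₁ bI) , trans (∣p-x∣+1≡∣p∣ a∈I) (rk I bI)) ,
    p⊆⁅x⁆∪q⇒p-x⊆q I⊆⁅a⁆∪B ,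
    basis-element∈K bI a∈I
    where
    a∈I : a ∈ I
    a∈I = ⁅a⁆⊆I (x∈⁅x⁆ a)

proposition4 : {n : ℕ} (M : Matroid n) (k : ℕ) → MatroidRank M k → 0 < k →
               (B : Subset n) → IsBasis M B →
               (a : Fin n) → InUnionF M k B a ⇔ InUnionBases M a
proposition4 M _ rk _ _ bB _ = mk⇔
  (λ (_ , _ , _ , a∈K[X]) → nonloop⇒inBasis M bB (K⇒nonloop M a∈K[X]))
  (λ a∈B′ → nonloop⇒inUnionF M rk bB (inBasis⇒nonloop M a∈B′))
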